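{- Let $X$ be a connected graph without loops and multiple edges. The family $B_{\mathrm{V}}X=\{e\cup\Omega_{\mathrm{V}}e\mid e\subseteq VX,\ |\theta e|<\infty\}$ is closed under finite intersections.
   Context: For $e\subseteq VX$, $e^{*}=VX\setminus e$ and $\theta e$ is the set of vertices of $e^{*}$ adjacent to a vertex of $e$. A vertex-cut is a nonempty $e$ with $\theta e$ finite. A ray is a sequence of pairwise distinct vertices with consecutive ones adjacent; it lies in $e$ if all but finitely many of its vertices are in $e$; $e$ separates two rays if one lies in $e$ and the other in $e^{*}$. Rays are vertex-equivalent if no vertex-cut separates them; classes are vertex-ends; a vertex-end lies in $e$ if all its rays lie in $e$; $\Omega_{\mathrm{V}}e$ is the set of vertex-ends lying in $e$. -}

module Defs where

open import Data.Nat using (ℕ; suc; _≤_)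
open import Data.Bool using (Bool; true; false)
open import Data.List using (List)
open import Data.List.Membership.Propositional using (_∈_)
open import Data.Product using (Σ; ∃; _×_; _,_)
open import Data.Sum using (_⊎_)
open import Relation.Nullary using (¬_)
open import Relation.Binary.PropositionalEquality using (_≡_)

-- A simple graph: adjacency is a symmetric irreflexive relation on an
-- arbitrary (possibly infinite) vertex type.  Being a relation, there are
-- no multiple edges; irreflexivity excludes loops.
data Walk {V : Set} (_∼_ : V → V → Set) : V → V → Set where
  here : ∀ {v} → Walk _∼_ v v
  step : ∀ {u v w} → u ∼ v → Walk _∼_ v w → Walk _∼_ u w

record Graph : Set₁ where
  field
    V     : Set
    _∼_   : V → V → Set
    sym   : ∀ {u v} → u ∼ v → v ∼ u
    irrefl : ∀ {v} → ¬ (v ∼ v)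

record ConnectedGraph : Set₁ where
  field
    graph     : Graph
  open Graph graph public
  field
    connected : ∀ u v → Walk _∼_ u v

module _ (X : ConnectedGraph) where
  open ConnectedGraph X

  VSubset : Set
  VSubset = V → Bool

  _∈ˢ_ : V → VSubset → Set
  v ∈ˢ e = e v ≡ true

  _∈*_ : V → VSubset → Set
  v ∈* e = e v ≡ false

  θ : VSubset → V → Set
  θ e w = (w ∈* e) × ∃ λ v → (v ∈ˢ e) × (v ∼ w)

  Finite : (V → Set) → Set
  Finite P = ∃ λ (L : List V) → ∀ v → P v → v ∈ L

  Nonempty : VSubset → Set
  Nonempty e = ∃ λ v → v ∈ˢ e

  VertexCut : VSubset → Set
  VertexCut e = Nonempty e × Finite (θ e)

  record Ray : Set where
    field
      seq : ℕ → V
      inj : ∀ m n → seq m ≡ seq n → m ≡ n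
      adj : ∀ n → seq n ∼ seq (suc n)
  open Ray public

  LiesIn : Ray → VSubset → Set
  LiesIn R e = ∃ λ N → ∀ n → N ≤ n → seq R n ∈ˢ e

  LiesIn* : Ray → VSubset → Set
  LiesIn* R e = ∃ λ N → ∀ n → N ≤ n → seq R n ∈* e

  Separates : VSubset → Ray → Ray → Set
  Separates e R R' = (LiesIn R e × LiesIn* R' e) ⊎ (LiesIn R' e × LiesIn* R e)

  VertexEquiv : Ray → Ray → Set
  VertexEquiv R R' = ¬ (∃ λ e → VertexCut e × Separates e R R')

  -- the vertex-end of R lies in e: every ray of its class lies in e
  -- (Ω_V e, represented by the rays whose end lies in e)
  EndLiesIn : Ray → VSubset → Set
  EndLiesIn R e = ∀ R' → VertexEquiv R R' → LiesIn R' e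

  Point : Set
  Point = V ⊎ Ray

  BV : VSubset → Point → Set
  BV e (Data.Sum.inj₁ v) = v ∈ˢ e
  BV e (Data.Sum.inj₂ R) = EndLiesIn R e

-- The intersection e₁ ∩ e₂ is the witness.  Its boundary lies in θ e₁ ∪ θ e₂,
-- since a boundary vertex leaves e₁ ∩ e₂ by leaving e₁ or e₂ while its
-- neighbour stays in both; and a ray lies eventually in both sets iff it lies
-- eventually in their intersection (take the larger threshold), so an end
-- lies in both sets iff it lies in the intersection.
module Submission where

open import Defs
open import Data.Bool using (true; false; _∧_)
open import Data.Bool.Properties using (∧-conicalˡ; ∧-conicalʳ)
open import Data.List using (_++_)
open import Data.List.Membership.Propositional.Properties using (∈-++⁺ˡ; ∈-++⁺ʳ)
open import Data.Nat using (_⊔_)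
open import Data.Nat.Properties using (m≤m⊔n; m≤n⊔m; ≤-trans)
open import Data.Product using (∃; _×_; _,_; proj₁; proj₂)
open import Data.Sum using (_⊎_; inj₁; inj₂)
open import Function.Bundles using (_⇔_; mk⇔; module Equivalence)
open import Relation.Binary.PropositionalEquality using (_≡_; refl)

open Equivalence using (to; from)

∧-intro : ∀ {x y} → x ≡ true → y ≡ true → x ∧ y ≡ true
∧-intro refl refl = refl

∧-≡-false : ∀ x {y} → x ∧ y ≡ false → x ≡ false ⊎ y ≡ false
∧-≡-false false _  = inj₁ refl
∧-≡-false true  eq = inj₂ eq

∧-≡-true⇔ : ∀ {x y} → (x ≡ true × y ≡ true) ⇔ (x ∧ y ≡ true)
∧-≡-true⇔ {x} {y} =
  mk⇔ (λ (p , q) → ∧-intro p q) (λ p → ∧-conicalˡ x y p , ∧-conicalʳ x y p)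

module _ (X : ConnectedGraph) where
  open ConnectedGraph X

  _∩_ : VSubset X → VSubset X → VSubset X
  (e₁ ∩ e₂) v = e₁ v ∧ e₂ v

  Finite-⊎ : ∀ {P Q : V → Set} →
    Finite X P → Finite X Q → Finite X (λ v → P v ⊎ Q v)
  Finite-⊎ (L , P⊆L) (M , Q⊆M) = L ++ M , λ where
    v (inj₁ Pv) → ∈-++⁺ˡ (P⊆L v Pv)
    v (inj₂ Qv) → ∈-++⁺ʳ L (Q⊆M v Qv)

  Finite-⊆ : ∀ {P Q : V → Set} →
    (∀ v → P v → Q v) → Finite X Q → Finite X P
  Finite-⊆ P⊆Q (L , Q⊆L) = L , λ v Pv → Q⊆L v (P⊆Q v Pv)

  θ-∩ : ∀ e₁ e₂ w → θ X (e₁ ∩ e₂) w → θ X e₁ w ⊎ θ X e₂ w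
  θ-∩ e₁ e₂ w (w∉ , v , v∈ , v∼w) with ∧-≡-false (e₁ w) w∉
  ... | inj₁ w∉e₁ = inj₁ (w∉e₁ , v , ∧-conicalˡ (e₁ v) (e₂ v) v∈ , v∼w)
  ... | inj₂ w∉e₂ = inj₂ (w∉e₂ , v , ∧-conicalʳ (e₁ v) (e₂ v) v∈ , v∼w)

  Finite-θ-∩ : ∀ e₁ e₂ →
    Finite X (θ X e₁) → Finite X (θ X e₂) → Finite X (θ X (e₁ ∩ e₂))
  Finite-θ-∩ e₁ e₂ fin₁ fin₂ = Finite-⊆ (θ-∩ e₁ e₂) (Finite-⊎ fin₁ fin₂)

  LiesIn-mono : ∀ {R e e'} → (∀ v → e v ≡ true → e' v ≡ true) →
    LiesIn X R e → LiesIn X R e'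
  LiesIn-mono e⊆e' (N , inE) = N , λ n N≤n → e⊆e' _ (inE n N≤n)

  LiesIn-∩ : ∀ R e₁ e₂ →
    (LiesIn X R e₁ × LiesIn X R e₂) ⇔ LiesIn X R (e₁ ∩ e₂)
  LiesIn-∩ R e₁ e₂ = mk⇔ both⇒∩ λ in∩ →
    LiesIn-mono {R} (λ v → ∧-conicalˡ (e₁ v) (e₂ v)) in∩ ,
    LiesIn-mono {R} (λ v → ∧-conicalʳ (e₁ v) (e₂ v)) in∩
    where
    both⇒∩ : LiesIn X R e₁ × LiesIn X R e₂ → LiesIn X R (e₁ ∩ e₂)
    both⇒∩ ((N₁ , in₁) , (N₂ , in₂)) = N₁ ⊔ N₂ , λ n N≤n →
      ∧-intro (in₁ n (≤-trans (m≤m⊔n N₁ N₂) N≤n))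
              (in₂ n (≤-trans (m≤n⊔m N₁ N₂) N≤n))

  EndLiesIn-∩ : ∀ R e₁ e₂ →
    (EndLiesIn X R e₁ × EndLiesIn X R e₂) ⇔ EndLiesIn X R (e₁ ∩ e₂)
  EndLiesIn-∩ R e₁ e₂ = mk⇔
    (λ (end₁ , end₂) R' R≈R' → to (LiesIn-∩ R' e₁ e₂) (end₁ R' R≈R' , end₂ R' R≈R'))
    (λ end∩ → (λ R' R≈R' → proj₁ (from (LiesIn-∩ R' e₁ e₂) (end∩ R' R≈R')))
            , (λ R' R≈R' → proj₂ (from (LiesIn-∩ R' e₁ e₂) (end∩ R' R≈R'))))

  BV-∩ : ∀ e₁ e₂ p → (BV X e₁ p × BV X e₂ p) ⇔ BV X (e₁ ∩ e₂) p
  BV-∩ e₁ e₂ (inj₁ v) = ∧-≡-true⇔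
  BV-∩ e₁ e₂ (inj₂ R) = EndLiesIn-∩ R e₁ e₂

lemma2 : (X : ConnectedGraph) → (e₁ e₂ : VSubset X) →
    Finite X (θ X e₁) → Finite X (θ X e₂) →
    ∃ λ (e₃ : VSubset X) → Finite X (θ X e₃) ×
      (∀ (p : Point X) → (BV X e₁ p × BV X e₂ p) ⇔ BV X e₃ p)
lemma2 X e₁ e₂ fin₁ fin₂ =
  _∩_ X e₁ e₂ , Finite-θ-∩ X e₁ e₂ fin₁ fin₂ , BV-∩ X e₁ e₂
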